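{- Let $G$ and $H$ be connected graphs with $\kappa(G)\ge 2$. Then \[\mathrm{sn}(G\square H)\geq \min\left(2|V(H)|,\ |V(G)|\lambda(H),\ (|V(G)|-2)\lambda(H)+2\delta(G)\right).\]
   Context: Graphs are finite, multiple edges allowed, no loops. $\kappa$ is vertex-connectivity, $\lambda$ edge-connectivity (edges counted with multiplicity), and $\delta(G)$ the minimum valence (number of incident edges) of a vertex of $G$. $G\square H$ is the Cartesian product: vertex set $V(G)\times V(H)$, with $(u_1,v_1)$ joined to $(u_2,v_2)$ by $e$ edges iff either $u_1=u_2$ and $v_1,v_2$ are joined by $e$ edges in $H$, or $v_1=v_2$ and $u_1,u_2$ are joined by $e$ edges in $G$. Scramble number: a scramble is a finite collection of nonempty vertex sets (eggs) each inducing a connected subgraph; a hitting set meets every egg and $h$ is the minimum hitting set size; an egg-cut is $A\subseteq V$ with some egg in $A$ and some egg in $A^C$, of size $|E(A,A^C)|$, and $e$ is the minimum egg-cut size ($+\infty$ if none); the order is $\min(h,e)$, and $\mathrm{sn}$ is the maximum order of a scramble. -}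

module Defs where

open import Data.Nat using (ℕ; zero; suc; _+_; _*_; _≤_; _<_; _⊓_)
open import Data.Bool using (Bool; true; false; _∧_; _∨_; not; if_then_else_)
open import Data.Fin using (Fin; remQuot; _≟_)
open import Data.Fin.Subset using (Subset; _∈_; _⊆_; ∁; ∣_∣)
open import Data.Vec using (Vec; []; _∷_; lookup; toList)
open import Data.List using (List; []; _∷_; map; _++_; allFin; foldr; filter; [_])
open import Data.Nat.ListAction using (sum)
open import Data.Bool.ListAction using (or)
open import Data.Product using (Σ; _×_; _,_; ∃)
open import Relation.Binary.PropositionalEquality using (_≡_)
open import Relation.Nullary.Decidable using (⌊_⌋)
open import Data.Bool.Properties using (T?)

-- A finite multigraph without loops on vertex set Fin n:
-- w i j = number of edges joining i and j.
record Graph : Set where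
  constructor mkGraph
  field
    n : ℕ
    w : Fin n → Fin n → ℕ
open Graph public

IsGraph : Graph → Set
IsGraph G = (∀ i j → w G i j ≡ w G j i) × (∀ i → w G i i ≡ 0)

Σᶠ : ∀ {n} → (Fin n → ℕ) → ℕ
Σᶠ {n} f = sum (map f (allFin n))

minL : ℕ → List ℕ → ℕ
minL d [] = d
minL d (x ∷ xs) = foldr _⊓_ x xs

deg : (G : Graph) → Fin (n G) → ℕ
deg G i = Σᶠ (λ j → w G i j)

δ : Graph → ℕ
δ G = minL 0 (map (deg G) (allFin (n G)))

cutSize : (G : Graph) → Subset (n G) → ℕ
cutSize G A = Σᶠ (λ i → Σᶠ (λ j →
  if lookup A i ∧ not (lookup A j) then w G i j else 0))

allSubsets : ∀ n → List (Subset n)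
allSubsets zero = [ [] ]
allSubsets (suc n) = map (false ∷_) (allSubsets n) ++ map (true ∷_) (allSubsets n)

nonemptyᵇ : ∀ {n} → Subset n → Bool
nonemptyᵇ A = or (toList A)

-- edge-connectivity λ(G): minimum size of an edge cut E(A,A^C) over nonempty
-- proper subsets A (convention: 0 if there is no such A, i.e. n ≤ 1)
edgeConn : Graph → ℕ
edgeConn G = minL 0 (map (cutSize G)
  (filter (λ A → T? (nonemptyᵇ A ∧ nonemptyᵇ (∁ A))) (allSubsets (n G))))

data WalkIn (G : Graph) (S : Subset (n G)) : Fin (n G) → Fin (n G) → Set where
  here : ∀ {u} → u ∈ S → WalkIn G S u u
  step : ∀ {u v x} → u ∈ S → 0 < w G u v → WalkIn G S v x → WalkIn G S u x

ConnectedSet : (G : Graph) → Subset (n G) → Set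
ConnectedSet G S = ∀ u v → u ∈ S → v ∈ S → WalkIn G S u v

allV : ∀ {n} → Subset n
allV {zero} = []
allV {suc n} = true ∷ allV

Connected : Graph → Set
Connected G = (1 ≤ n G) × ConnectedSet G allV

VertexConnAtLeast : Graph → ℕ → Set
VertexConnAtLeast G k = (k < n G) × (∀ (S : Subset (n G)) → ∣ S ∣ < k → ConnectedSet G (∁ S))

_□_ : Graph → Graph → Graph
G □ H = mkGraph (n G * n H) wP
  where
  wP : Fin (n G * n H) → Fin (n G * n H) → ℕ
  wP x y with remQuot (n H) x | remQuot (n H) y
  ... | (u₁ , v₁) | (u₂ , v₂) =
    if ⌊ u₁ ≟ u₂ ⌋ then w H v₁ v₂
    else (if ⌊ v₁ ≟ v₂ ⌋ then w G u₁ u₂ else 0)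

IsScramble : (G : Graph) → List (Subset (n G)) → Set
IsScramble G 𝓔 = ∀ E → E Data.List.Membership.Propositional.∈ 𝓔 → (∃ λ v → v ∈ E) × ConnectedSet G E
  where import Data.List.Membership.Propositional

IsHittingSet : (G : Graph) → List (Subset (n G)) → Subset (n G) → Set
IsHittingSet G 𝓔 S = ∀ E → E Data.List.Membership.Propositional.∈ 𝓔 → ∃ λ v → v ∈ E × v ∈ S
  where import Data.List.Membership.Propositional

IsEggCut : (G : Graph) → List (Subset (n G)) → Subset (n G) → Set
IsEggCut G 𝓔 A =
  (∃ λ E → E Data.List.Membership.Propositional.∈ 𝓔 × E ⊆ A) ×
  (∃ λ E → E Data.List.Membership.Propositional.∈ 𝓔 × E ⊆ ∁ A)
  where import Data.List.Membership.Propositional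

-- order(𝓔) = min(h, e) ≥ m  (with e = +∞ when there is no egg-cut)
OrderAtLeast : (G : Graph) → List (Subset (n G)) → ℕ → Set
OrderAtLeast G 𝓔 m =
  (∀ S → IsHittingSet G 𝓔 S → m ≤ ∣ S ∣) ×
  (∀ A → IsEggCut G 𝓔 A → m ≤ cutSize G A)

SnAtLeast : Graph → ℕ → Set
SnAtLeast G m = Σ (List (Subset (n G))) λ 𝓔 → IsScramble G 𝓔 × OrderAtLeast G 𝓔 m

-- The eggs are the copies {(u , v) : u ≠ a} of G − a in the G-layers of G □ H; they are connected
-- because κ(G) ≥ 2.  A hitting set meets each G-layer twice (once in the egg avoiding some a, at
-- u₁, and again in the egg avoiding u₁), so it has at least 2|V(H)| vertices.  An egg-cut A
-- containing the egg at (a , v) and avoiding the egg at (b , v′) forces v ≠ v′, and its size is at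
-- least the sum of the cuts that A induces on all H-fibres and all G-layers.  For u ∉ {a , b} the
-- H-fibre over u separates v from v′, contributing λ(H); around a (and around b) either that
-- H-fibre is separated too, or a whole G-layer is split off one vertex, contributing δ(G).  So
-- |E(A , Aᶜ)| ≥ (|V(G)| − 2) λ(H) + 2 min(λ(H) , δ(G)), which is exactly the minimum of the last
-- two terms of the bound.
module Submission where

open import Data.Nat using (ℕ; zero; suc; _+_; _*_; _∸_; _≤_; _<_; _⊓_; z≤n; s≤s)
open import Data.Nat.Properties hiding (_≟_)
open import Data.Nat.ListAction using () renaming (sum to sumˡ)
open import Algebra.Properties.CommutativeMonoid.Sum +-0-commutativeMonoid
  using (sum; sum-syntax; sum-remove; sum-cong-≗; ∑-comm; ∑-distrib-+)
open import Algebra.Properties.CommutativeSemigroup +-commutativeSemigroup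
  using (interchange; x∙yz≈yx∙z; xy∙z≈xz∙y)
open import Data.Bool using (Bool; true; false; _∧_; _∨_; not; if_then_else_; T)
open import Data.Bool.Properties using (∧-inverseʳ; ∨-zeroʳ; ¬-not)
open import Data.Fin using (Fin; zero; suc; _↑ˡ_; _↑ʳ_; combine; remQuot; quotient; remainder;
  punchIn; punchOut; fromℕ<; _≟_)
open import Data.Fin.Properties using (punchInᵢ≢i; punchIn-injective; punchIn-punchOut;
  remQuot-combine; combine-remQuot)
open import Data.Fin.Subset using (Subset; _∈_; _⊆_; ∁; ⁅_⁆; ∣_∣)
open import Data.Fin.Subset.Properties using (x∈∁p⇒x∉p; x∉p⇒x∈∁p; x∈⁅x⁆; x∈⁅y⁆⇒x≡y; ∣⁅x⁆∣≡1)
open import Data.Vec using ([]; _∷_; lookup; tabulate)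
open import Data.Vec.Properties using (lookup∘tabulate; lookup-map; []=⇒lookup; lookup⇒[]=)
open import Data.List using (List; []; _∷_; map; foldr; allFin; cartesianProductWith)
import Data.List as List
open import Data.List.Properties using (map-tabulate)
open import Data.List.Membership.Propositional using () renaming (_∈_ to _∈ₗ_)
open import Data.List.Membership.Propositional.Properties
  using (∈-map⁺; ∈-++⁺ˡ; ∈-++⁺ʳ; ∈-filter⁺; ∈-allFin; ∈-cartesianProductWith⁺; ∈-cartesianProductWith⁻)
open import Data.List.Relation.Unary.Any using (here; there)
open import Data.Product using (∃; ∃₂; _×_; _,_; proj₁; proj₂)
open import Data.Unit using (tt)
open import Function using (_∘_; id)
open import Relation.Binary.PropositionalEquality
open import Relation.Nullary using (Dec; yes; no; does)
open import Relation.Nullary.Decidable using (⌊_⌋; dec-true)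
open import Relation.Nullary.Negation using (contradiction)

open import Defs

Σᶠ≡sum : ∀ {n} (f : Fin n → ℕ) → Σᶠ f ≡ sum f
Σᶠ≡sum f = trans (cong sumˡ (map-tabulate id f)) (sumˡ-tabulate f)
  where
  sumˡ-tabulate : ∀ {n} (f : Fin n → ℕ) → sumˡ (List.tabulate f) ≡ sum f
  sumˡ-tabulate {zero}  f = refl
  sumˡ-tabulate {suc n} f = cong (f zero +_) (sumˡ-tabulate (f ∘ suc))

sum-mono-≤ : ∀ {n} {f g : Fin n → ℕ} → (∀ i → f i ≤ g i) → sum f ≤ sum g
sum-mono-≤ {zero}  f≤g = z≤n
sum-mono-≤ {suc n} f≤g = +-mono-≤ (f≤g zero) (sum-mono-≤ (f≤g ∘ suc))

n*c≤sum : ∀ {n c} (f : Fin n → ℕ) → (∀ i → c ≤ f i) → n * c ≤ sum f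
n*c≤sum {zero}  f c≤f = z≤n
n*c≤sum {suc n} f c≤f = +-mono-≤ (c≤f zero) (n*c≤sum (f ∘ suc) (c≤f ∘ suc))

fᵢ≤sum : ∀ {n} (f : Fin n → ℕ) i → f i ≤ sum f
fᵢ≤sum {suc n} f i = subst (f i ≤_) (sym (sum-remove f)) (m≤m+n (f i) _)

fᵢ+fⱼ+[n∸2]c≤sum : ∀ {n c} (f : Fin n → ℕ) {i j} → i ≢ j →
  (∀ k → k ≢ i → k ≢ j → c ≤ f k) → f i + f j + (n ∸ 2) * c ≤ sum f
fᵢ+fⱼ+[n∸2]c≤sum {suc zero}    f {zero} {zero} i≢j _ = contradiction refl i≢j
fᵢ+fⱼ+[n∸2]c≤sum {suc (suc n)} {c} f {i} {j} i≢j c≤f = begin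
  f i + f j + n * c                    ≡⟨ +-assoc (f i) (f j) (n * c) ⟩
  f i + (f j + n * c)                  ≡⟨ cong (λ x → f i + (x + n * c)) (cong f (punchIn-punchOut i≢j)) ⟨
  f i + (g j′ + n * c)                 ≤⟨ +-monoʳ-≤ (f i) (+-monoʳ-≤ (g j′) (n*c≤sum (g ∘ punchIn j′) c≤rest)) ⟩
  f i + (g j′ + sum (g ∘ punchIn j′))  ≡⟨ cong (f i +_) (sum-remove g) ⟨
  f i + sum g                          ≡⟨ sum-remove f ⟨
  sum f                                ∎
  where
  open ≤-Reasoning
  g = f ∘ punchIn i
  j′ = punchOut i≢j
  c≤rest : ∀ k → c ≤ g (punchIn j′ k)
  c≤rest k = c≤f _ (punchInᵢ≢i i _)
    (λ eq → punchInᵢ≢i j′ k (punchIn-injective i _ _ (trans eq (sym (punchIn-punchOut i≢j)))))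

fᵢ+fⱼ≤sum : ∀ {n} (f : Fin n → ℕ) {i j} → i ≢ j → f i + f j ≤ sum f
fᵢ+fⱼ≤sum {n} f i≢j =
  ≤-trans (m≤m+n _ ((n ∸ 2) * 0)) (fᵢ+fⱼ+[n∸2]c≤sum f i≢j (λ _ _ _ → z≤n))

[n∸2]c+k≤sum+sum : ∀ {m n c k} (f : Fin m → ℕ) (g : Fin n → ℕ) {i j i′ j′} → i ≢ j → i′ ≢ j′ →
  (∀ l → l ≢ i → l ≢ j → c ≤ f l) → k ≤ (f i + f j) + (g i′ + g j′) →
  (m ∸ 2) * c + k ≤ sum f + sum g
[n∸2]c+k≤sum+sum {m} {c = c} {k} f g {i} {j} {i′} {j′} i≢j i′≢j′ c≤f k≤ = begin
  (m ∸ 2) * c + k                              ≤⟨ +-monoʳ-≤ ((m ∸ 2) * c) k≤ ⟩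
  (m ∸ 2) * c + ((f i + f j) + (g i′ + g j′))  ≡⟨ x∙yz≈yx∙z ((m ∸ 2) * c) (f i + f j) (g i′ + g j′) ⟩
  (f i + f j + (m ∸ 2) * c) + (g i′ + g j′)    ≤⟨ +-mono-≤ (fᵢ+fⱼ+[n∸2]c≤sum f i≢j c≤f) (fᵢ+fⱼ≤sum g i′≢j′) ⟩
  sum f + sum g                                ∎
  where open ≤-Reasoning

row+col≤sum : ∀ {m n} (F : Fin m → Fin n → ℕ) i j → F i j ≡ 0 →
  sum (F i) + sum (λ k → F k j) ≤ sum (λ k → sum (F k))
row+col≤sum {suc m} F i j Fij≡0 = begin
  sum (F i) + sum (λ k → F k j)                  ≡⟨ cong (sum (F i) +_) (sum-remove {i = i} (λ k → F k j)) ⟩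
  sum (F i) + (F i j + sum (F′ j))               ≡⟨ cong (λ x → sum (F i) + (x + sum (F′ j))) Fij≡0 ⟩
  sum (F i) + sum (F′ j)                         ≤⟨ +-monoʳ-≤ (sum (F i)) (sum-mono-≤ (λ k → fᵢ≤sum (F (punchIn i k)) j)) ⟩
  sum (F i) + sum (λ k → sum (F (punchIn i k)))  ≡⟨ sum-remove (λ k → sum (F k)) ⟨
  sum (λ k → sum (F k))                          ∎
  where
  open ≤-Reasoning
  F′ : Fin _ → Fin m → ℕ
  F′ j k = F (punchIn i k) j

sum-↑ : ∀ {m n} (f : Fin (m + n) → ℕ) → sum f ≡ sum (λ i → f (i ↑ˡ n)) + sum (λ j → f (m ↑ʳ j))
sum-↑ {zero}  f = refl
sum-↑ {suc m} f = trans (cong (f zero +_) (sum-↑ {m} (f ∘ suc))) (sym (+-assoc (f zero) _ _))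

sum-combine : ∀ {m n} (f : Fin (m * n) → ℕ) → sum f ≡ ∑[ i < m ] ∑[ j < n ] f (combine i j)
sum-combine {zero}      f = refl
sum-combine {suc m} {n} f =
  trans (sum-↑ {n} f) (cong (sum (λ j → f (j ↑ˡ m * n)) +_) (sum-combine {m} (f ∘ (n ↑ʳ_))))

∣p∣≡sum : ∀ {n} (p : Subset n) → ∣ p ∣ ≡ sum (λ i → if lookup p i then 1 else 0)
∣p∣≡sum []          = refl
∣p∣≡sum (true ∷ p)  = cong suc (∣p∣≡sum p)
∣p∣≡sum (false ∷ p) = ∣p∣≡sum p

minL≤ : ∀ d {xs x} → x ∈ₗ xs → minL d xs ≤ x
minL≤ d {y ∷ ys} = foldr-⊓≤
  where
  foldr-⊓≤ : ∀ {y zs x} → x ∈ₗ y ∷ zs → foldr _⊓_ y zs ≤ x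
  foldr-⊓≤ {zs = []}     (here refl)         = ≤-refl
  foldr-⊓≤ {zs = z ∷ zs} (here refl)         = ≤-trans (m⊓n≤n z _) (foldr-⊓≤ {zs = zs} (here refl))
  foldr-⊓≤ {zs = z ∷ zs} (there (here refl)) = m⊓n≤m _ _
  foldr-⊓≤ {zs = z ∷ zs} (there (there x∈))  = ≤-trans (m⊓n≤n z _) (foldr-⊓≤ (there x∈))

∈-allSubsets : ∀ {n} (B : Subset n) → B ∈ₗ allSubsets n
∈-allSubsets []          = here refl
∈-allSubsets (false ∷ B) = ∈-++⁺ˡ (∈-map⁺ (false ∷_) (∈-allSubsets B))
∈-allSubsets {suc n} (true ∷ B) =
  ∈-++⁺ʳ (map (false ∷_) (allSubsets n)) (∈-map⁺ (true ∷_) (∈-allSubsets B))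

lookup⇒nonemptyᵇ : ∀ {n} (B : Subset n) i → lookup B i ≡ true → nonemptyᵇ B ≡ true
lookup⇒nonemptyᵇ (b ∷ B) zero    refl = refl
lookup⇒nonemptyᵇ (b ∷ B) (suc i) Bi   = trans (cong (b ∨_) (lookup⇒nonemptyᵇ B i Bi)) (∨-zeroʳ b)

edgeConn≤cutSize : ∀ K (B : Fin (n K) → Bool) {i j} → B i ≡ true → B j ≡ false →
  edgeConn K ≤ cutSize K (tabulate B)
edgeConn≤cutSize K B {i} {j} Bi Bj =
  minL≤ 0 (∈-map⁺ (cutSize K) (∈-filter⁺ _ (∈-allSubsets (tabulate B)) proper))
  where
  i∈B : lookup (tabulate B) i ≡ true
  i∈B = trans (lookup∘tabulate B i) Bi
  j∈∁B : lookup (∁ (tabulate B)) j ≡ true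
  j∈∁B = trans (lookup-map j not (tabulate B)) (cong not (trans (lookup∘tabulate B j) Bj))
  proper : T (nonemptyᵇ (tabulate B) ∧ nonemptyᵇ (∁ (tabulate B)))
  proper = subst T (sym (cong₂ _∧_ (lookup⇒nonemptyᵇ (tabulate B) i i∈B)
                                  (lookup⇒nonemptyᵇ (∁ (tabulate B)) j j∈∁B))) tt

δ≤deg : ∀ K i → δ K ≤ deg K i
δ≤deg K i = minL≤ 0 (∈-map⁺ (deg K) (∈-allFin i))

cutTerm : (K : Graph) → (Fin (n K) → Bool) → Fin (n K) → Fin (n K) → ℕ
cutTerm K B i j = if B i ∧ not (B j) then w K i j else 0

cutTerm-diag : ∀ K B i → cutTerm K B i i ≡ 0
cutTerm-diag K B i rewrite ∧-inverseʳ (B i) = refl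

cutTerm-cong : ∀ K {B B′} → (∀ i → B i ≡ B′ i) → ∀ i j → cutTerm K B i j ≡ cutTerm K B′ i j
cutTerm-cong K B≗B′ i j = cong₂ (λ b b′ → if b ∧ not b′ then w K i j else 0) (B≗B′ i) (B≗B′ j)

cutSize≡∑∑ : ∀ K (B : Subset (n K)) → cutSize K B ≡ ∑[ i < n K ] ∑[ j < n K ] cutTerm K (lookup B) i j
cutSize≡∑∑ K B = trans (Σᶠ≡sum {n K} _) (sum-cong-≗ λ i → Σᶠ≡sum (cutTerm K (lookup B) i))

cutSize-tabulate : ∀ K (B : Fin (n K) → Bool) →
  cutSize K (tabulate B) ≡ ∑[ i < n K ] ∑[ j < n K ] cutTerm K B i j
cutSize-tabulate K B = trans (cutSize≡∑∑ K (tabulate B))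
  (sum-cong-≗ λ i → sum-cong-≗ {n K} (cutTerm-cong K (lookup∘tabulate B) i))

module _ (K : Graph) (isGraph : IsGraph K) where

  private
    w≡cutTerm : ∀ B i j → (i ≢ j → B i ∧ not (B j) ≡ true) → w K i j ≡ cutTerm K B i j
    w≡cutTerm B i j crosses with i ≟ j
    ... | yes refl = trans (proj₂ isGraph i) (sym (cutTerm-diag K B i))
    ... | no i≢j rewrite crosses i≢j = refl

  deg≤cutSize-⁅i⁆ : ∀ B {i} → B i ≡ true → (∀ {j} → j ≢ i → B j ≡ false) →
    deg K i ≤ cutSize K (tabulate B)
  deg≤cutSize-⁅i⁆ B {i} Bi others = begin
    deg K i                           ≡⟨ Σᶠ≡sum (w K i) ⟩
    sum (w K i)                       ≡⟨ sum-cong-≗ (λ j → w≡cutTerm B i j (crosses j ∘ ≢-sym)) ⟩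
    sum (cutTerm K B i)               ≤⟨ fᵢ≤sum (λ k → sum (cutTerm K B k)) i ⟩
    ∑[ k < n K ] sum (cutTerm K B k)  ≡⟨ cutSize-tabulate K B ⟨
    cutSize K (tabulate B)            ∎
    where
    open ≤-Reasoning
    crosses : ∀ j → j ≢ i → B i ∧ not (B j) ≡ true
    crosses j j≢i rewrite Bi | others j≢i = refl

  deg≤cutSize-∁⁅i⁆ : ∀ B {i} → B i ≡ false → (∀ {j} → j ≢ i → B j ≡ true) →
    deg K i ≤ cutSize K (tabulate B)
  deg≤cutSize-∁⁅i⁆ B {i} Bi others = begin
    deg K i                           ≡⟨ Σᶠ≡sum (w K i) ⟩
    sum (w K i)                       ≡⟨ sum-cong-≗ (λ k → trans (proj₁ isGraph i k) (w≡cutTerm B k i (crosses k))) ⟩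
    sum (λ k → cutTerm K B k i)       ≤⟨ sum-mono-≤ (λ k → fᵢ≤sum (cutTerm K B k) i) ⟩
    ∑[ k < n K ] sum (cutTerm K B k)  ≡⟨ cutSize-tabulate K B ⟨
    cutSize K (tabulate B)            ∎
    where
    open ≤-Reasoning
    crosses : ∀ j → j ≢ i → B j ∧ not (B i) ≡ true
    crosses j j≢i rewrite Bi | others j≢i = refl

module _ (G H : Graph) where

  private
    w-□-coordinates : Fin (n G) × Fin (n H) → Fin (n G) × Fin (n H) → ℕ
    w-□-coordinates (u₁ , v₁) (u₂ , v₂) =
      if ⌊ u₁ ≟ u₂ ⌋ then w H v₁ v₂ else (if ⌊ v₁ ≟ v₂ ⌋ then w G u₁ u₂ else 0)

    w-□-remQuot : ∀ x y → w (G □ H) x y ≡ w-□-coordinates (remQuot (n H) x) (remQuot (n H) y)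
    w-□-remQuot x y with remQuot {n G} (n H) x | remQuot {n G} (n H) y
    ... | _ | _ = refl

  w-□ : ∀ u₁ v₁ u₂ v₂ → w (G □ H) (combine u₁ v₁) (combine u₂ v₂) ≡
        (if ⌊ u₁ ≟ u₂ ⌋ then w H v₁ v₂ else (if ⌊ v₁ ≟ v₂ ⌋ then w G u₁ u₂ else 0))
  w-□ u₁ v₁ u₂ v₂ = trans (w-□-remQuot _ _)
    (cong₂ w-□-coordinates (remQuot-combine u₁ v₁) (remQuot-combine u₂ v₂))

  w-□-vertical : ∀ u v₁ v₂ → w (G □ H) (combine u v₁) (combine u v₂) ≡ w H v₁ v₂
  w-□-vertical u v₁ v₂ with u ≟ u | w-□ u v₁ u v₂
  ... | yes _  | eq = eq
  ... | no u≢u | _  = contradiction refl u≢u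

  w-□-horizontal : ∀ {u₁ u₂} v → u₁ ≢ u₂ → w (G □ H) (combine u₁ v) (combine u₂ v) ≡ w G u₁ u₂
  w-□-horizontal {u₁} {u₂} v u₁≢u₂ with u₁ ≟ u₂ | v ≟ v | w-□ u₁ v u₂ v
  ... | yes u₁≡u₂ | _      | _  = contradiction u₁≡u₂ u₁≢u₂
  ... | no _      | yes _  | eq = eq
  ... | no _      | no v≢v | _  = contradiction refl v≢v

  layer : Subset (n G) → Fin (n H) → Subset (n G * n H)
  layer S v = tabulate (λ x → lookup S (quotient (n H) x) ∧ does (remainder {n G} (n H) x ≟ v))

  lookup-layer : ∀ S v u y → lookup (layer S v) (combine u y) ≡ lookup S u ∧ does (y ≟ v)
  lookup-layer S v u y = trans (lookup∘tabulate _ (combine u y))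
    (cong (λ (p : Fin (n G) × Fin (n H)) → lookup S (proj₁ p) ∧ does (proj₂ p ≟ v)) (remQuot-combine u y))

  ∈-layer⁺ : ∀ {S u} v → u ∈ S → combine u v ∈ layer S v
  ∈-layer⁺ {S} {u} v u∈S = lookup⇒[]= _ _
    (trans (lookup-layer S v u v) (cong₂ _∧_ ([]=⇒lookup u∈S) (dec-true (v ≟ v) refl)))

  ∈-layer⁻ : ∀ {S v} x → x ∈ layer S v → ∃ λ u → u ∈ S × x ≡ combine u v
  ∈-layer⁻ {S} {v} x x∈ = coordinates-in-layer (subst (_∈ layer S v) x≡ x∈)
    where
    u = quotient {n G} (n H) x
    y = remainder {n G} (n H) x
    x≡ : x ≡ combine u y
    x≡ = sym (combine-remQuot {n G} (n H) x)
    coordinates-in-layer : combine u y ∈ layer S v → ∃ λ u′ → u′ ∈ S × x ≡ combine u′ v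
    coordinates-in-layer cu∈ with lookup S u in Su | y ≟ v | trans (sym (lookup-layer S v u y)) ([]=⇒lookup cu∈)
    ... | true  | yes refl | _  = u , lookup⇒[]= u S Su , x≡
    ... | true  | no _     | ()
    ... | false | _        | ()

  walkIn-layer : (∀ u → w G u u ≡ 0) → ∀ {S u₁ u₂} v → WalkIn G S u₁ u₂ →
    WalkIn (G □ H) (layer S v) (combine u₁ v) (combine u₂ v)
  walkIn-layer irr v (here u∈S) = here (∈-layer⁺ v u∈S)
  walkIn-layer irr v (step u∈S edge walk) =
    step (∈-layer⁺ v u∈S) (subst (0 <_) (sym (w-□-horizontal v (ends-distinct edge))) edge) (walkIn-layer irr v walk)
    where
    ends-distinct : ∀ {u u′} → 0 < w G u u′ → u ≢ u′
    ends-distinct {u} edge refl = <-irrefl (sym (irr u)) edge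

  layer-connected : (∀ u → w G u u ≡ 0) → ∀ {S} v → ConnectedSet G S → ConnectedSet (G □ H) (layer S v)
  layer-connected irr v conn x y x∈ y∈ with ∈-layer⁻ x x∈ | ∈-layer⁻ y y∈
  ... | u₁ , u₁∈S , refl | u₂ , u₂∈S , refl = walkIn-layer irr v (conn u₁ u₂ u₁∈S u₂∈S)

  hFibre : Subset (n G * n H) → Fin (n G) → Fin (n H) → Bool
  hFibre A u v = lookup A (combine u v)

  gFibre : Subset (n G * n H) → Fin (n H) → Fin (n G) → Bool
  gFibre A v u = lookup A (combine u v)

  module _ (A : Subset (n G * n H)) where

    private
      term : Fin (n G * n H) → Fin (n G * n H) → ℕ
      term = cutTerm (G □ H) (lookup A)

      term-vertical : ∀ u v₁ v₂ → term (combine u v₁) (combine u v₂) ≡ cutTerm H (hFibre A u) v₁ v₂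
      term-vertical u v₁ v₂ = cong (if hFibre A u v₁ ∧ not (hFibre A u v₂) then_else 0) (w-□-vertical u v₁ v₂)

      term-horizontal : ∀ u₁ u₂ v → term (combine u₁ v) (combine u₂ v) ≡ cutTerm G (gFibre A v) u₁ u₂
      term-horizontal u₁ u₂ v with u₁ ≟ u₂
      ... | yes refl = trans (cutTerm-diag (G □ H) (lookup A) _) (sym (cutTerm-diag G (gFibre A v) u₁))
      ... | no u₁≢u₂ = cong (if gFibre A v u₁ ∧ not (gFibre A v u₂) then_else 0) (w-□-horizontal v u₁≢u₂)

      hTerm : Fin (n G) → Fin (n H) → ℕ
      hTerm u v = sum (cutTerm H (hFibre A u) v)

      gTerm : Fin (n G) → Fin (n H) → ℕ
      gTerm u v = sum (cutTerm G (gFibre A v) u)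

      ∑term-from : Fin (n G) → Fin (n H) → ℕ
      ∑term-from u₁ v₁ = ∑[ u₂ < n G ] ∑[ v₂ < n H ] term (combine u₁ v₁) (combine u₂ v₂)

      hTerm+gTerm≤∑term-from : ∀ u v → hTerm u v + gTerm u v ≤ ∑term-from u v
      hTerm+gTerm≤∑term-from u v = subst (_≤ ∑term-from u v)
        (cong₂ _+_ (sum-cong-≗ (term-vertical u v)) (sum-cong-≗ λ u₂ → term-horizontal u u₂ v))
        (row+col≤sum (λ u₂ v₂ → term (combine u v) (combine u₂ v₂)) u v (cutTerm-diag (G □ H) (lookup A) _))

    ∑cutSize-fibres≤cutSize-□ :
      ∑[ u < n G ] cutSize H (tabulate (hFibre A u)) + ∑[ v < n H ] cutSize G (tabulate (gFibre A v))
        ≤ cutSize (G □ H) A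
    ∑cutSize-fibres≤cutSize-□ = begin
      ∑[ u < n G ] cutSize H (tabulate (hFibre A u)) + ∑[ v < n H ] cutSize G (tabulate (gFibre A v))
        ≡⟨ cong₂ _+_ (sum-cong-≗ λ u → cutSize-tabulate H (hFibre A u))
                     (sum-cong-≗ λ v → cutSize-tabulate G (gFibre A v)) ⟩
      ∑[ u < n G ] ∑[ v < n H ] hTerm u v + ∑[ v < n H ] ∑[ u < n G ] gTerm u v
        ≡⟨ cong (∑[ u < n G ] ∑[ v < n H ] hTerm u v +_) (∑-comm (λ v u → gTerm u v)) ⟩
      ∑[ u < n G ] ∑[ v < n H ] hTerm u v + ∑[ u < n G ] ∑[ v < n H ] gTerm u v
        ≡⟨ ∑-distrib-+ (λ u → ∑[ v < n H ] hTerm u v) _ ⟨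
      ∑[ u < n G ] (∑[ v < n H ] hTerm u v + ∑[ v < n H ] gTerm u v)
        ≡⟨ sum-cong-≗ (λ u → ∑-distrib-+ (hTerm u) (gTerm u)) ⟨
      ∑[ u < n G ] ∑[ v < n H ] (hTerm u v + gTerm u v)
        ≤⟨ sum-mono-≤ (λ u → sum-mono-≤ (hTerm+gTerm≤∑term-from u)) ⟩
      ∑[ u < n G ] ∑[ v < n H ] ∑term-from u v
        ≡⟨ sum-cong-≗ {n G} (λ u → sum-cong-≗ {n H} λ v → sum-combine {n G} (term (combine u v))) ⟨
      ∑[ u < n G ] ∑[ v < n H ] ∑[ y < n G * n H ] term (combine u v) y
        ≡⟨ sum-combine {n G} (λ x → ∑[ y < n G * n H ] term x y) ⟨
      ∑[ x < n G * n H ] ∑[ y < n G * n H ] term x y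
        ≡⟨ cutSize≡∑∑ (G □ H) A ⟨
      cutSize (G □ H) A
        ∎
      where open ≤-Reasoning

third-vertex : ∀ {m} → 2 < m → (a b : Fin m) → ∃ λ c → c ≢ a × c ≢ b
third-vertex (s≤s (s≤s (s≤s _))) zero          zero          = suc zero , (λ ()) , (λ ())
third-vertex (s≤s (s≤s (s≤s _))) zero          (suc zero)    = suc (suc zero) , (λ ()) , (λ ())
third-vertex (s≤s (s≤s (s≤s _))) zero          (suc (suc _)) = suc zero , (λ ()) , (λ ())
third-vertex (s≤s (s≤s (s≤s _))) (suc zero)    zero          = suc (suc zero) , (λ ()) , (λ ())
third-vertex (s≤s (s≤s (s≤s _))) (suc zero)    (suc _)       = zero , (λ ()) , (λ ())
third-vertex (s≤s (s≤s (s≤s _))) (suc (suc _)) zero          = suc zero , (λ ()) , (λ ())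
third-vertex (s≤s (s≤s (s≤s _))) (suc (suc _)) (suc _)       = zero , (λ ()) , (λ ())

n*L⊓[[n∸2]*L+2*D]≡[n∸2]*L+2*[L⊓D] : ∀ {n} → 2 ≤ n → ∀ L D →
  (n * L) ⊓ ((n ∸ 2) * L + 2 * D) ≡ (n ∸ 2) * L + 2 * (L ⊓ D)
n*L⊓[[n∸2]*L+2*D]≡[n∸2]*L+2*[L⊓D] {n} 2≤n L D = sym (begin
  (n ∸ 2) * L + 2 * (L ⊓ D)                      ≡⟨ cong ((n ∸ 2) * L +_) (*-distribˡ-⊓ 2 L D) ⟩
  (n ∸ 2) * L + ((2 * L) ⊓ (2 * D))              ≡⟨ +-distribˡ-⊓ ((n ∸ 2) * L) (2 * L) (2 * D) ⟩
  ((n ∸ 2) * L + 2 * L) ⊓ ((n ∸ 2) * L + 2 * D)  ≡⟨ cong (_⊓ ((n ∸ 2) * L + 2 * D)) [n∸2]*L+2*L≡n*L ⟩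
  (n * L) ⊓ ((n ∸ 2) * L + 2 * D)                ∎)
  where
  open ≡-Reasoning
  [n∸2]*L+2*L≡n*L : (n ∸ 2) * L + 2 * L ≡ n * L
  [n∸2]*L+2*L≡n*L = trans (sym (*-distribʳ-+ L (n ∸ 2) 2)) (cong (_* L) (m∸n+n≡m 2≤n))

module _ (G H : Graph) (isGraph : IsGraph G) (κ≥2 : VertexConnAtLeast G 2) where

  egg : Fin (n G) → Fin (n H) → Subset (n G * n H)
  egg a v = layer G H (∁ ⁅ a ⁆) v

  ∈-egg⁺ : ∀ {a u} v → u ≢ a → combine u v ∈ egg a v
  ∈-egg⁺ {a} v u≢a = ∈-layer⁺ G H v (x∉p⇒x∈∁p (u≢a ∘ x∈⁅y⁆⇒x≡y a))

  ∈-egg⁻ : ∀ {a v} x → x ∈ egg a v → ∃ λ u → u ≢ a × x ≡ combine u v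
  ∈-egg⁻ {a} x x∈ with ∈-layer⁻ G H x x∈
  ... | u , u∈∁a , x≡ = u , (λ u≡a → x∈∁p⇒x∉p u∈∁a (subst (_∈ ⁅ a ⁆) (sym u≡a) (x∈⁅x⁆ a))) , x≡

  eggs : List (Subset (n G * n H))
  eggs = cartesianProductWith egg (allFin (n G)) (allFin (n H))

  egg∈eggs : ∀ a v → egg a v ∈ₗ eggs
  egg∈eggs a v = ∈-cartesianProductWith⁺ egg (∈-allFin a) (∈-allFin v)

  ∈-eggs⁻ : ∀ {E} → E ∈ₗ eggs → ∃₂ λ a v → E ≡ egg a v
  ∈-eggs⁻ E∈ with ∈-cartesianProductWith⁻ egg (allFin (n G)) (allFin (n H)) E∈
  ... | a , v , _ , _ , E≡ = a , v , E≡

  eggs-scramble : IsScramble (G □ H) eggs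
  eggs-scramble E E∈ with ∈-eggs⁻ E∈
  ... | a , v , refl =
    (_ , ∈-egg⁺ v (proj₁ (proj₂ (third-vertex (proj₁ κ≥2) a a)))) ,
    layer-connected G H (proj₂ isGraph) v (proj₂ κ≥2 ⁅ a ⁆ (≤-reflexive (cong suc (∣⁅x⁆∣≡1 a))))

  hittingSet-size : ∀ S → IsHittingSet (G □ H) eggs S → 2 * n H ≤ ∣ S ∣
  hittingSet-size S hits = begin
    2 * n H                                    ≡⟨ *-comm 2 (n H) ⟩
    n H * 2                                    ≤⟨ n*c≤sum (λ v → ∑[ u < n G ] 𝟙 (combine u v)) two-in-layer ⟩
    ∑[ v < n H ] ∑[ u < n G ] 𝟙 (combine u v)  ≡⟨ ∑-comm {n G} (λ u v → 𝟙 (combine u v)) ⟨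
    ∑[ u < n G ] ∑[ v < n H ] 𝟙 (combine u v)  ≡⟨ sum-combine {n G} 𝟙 ⟨
    sum 𝟙                                      ≡⟨ ∣p∣≡sum S ⟨
    ∣ S ∣                                      ∎
    where
    open ≤-Reasoning
    𝟙 : Fin (n G * n H) → ℕ
    𝟙 x = if lookup S x then 1 else 0
    𝟙≡1 : ∀ {x} → x ∈ S → 𝟙 x ≡ 1
    𝟙≡1 x∈S rewrite []=⇒lookup x∈S = refl
    a₀ : Fin (n G)
    a₀ = fromℕ< (proj₁ κ≥2)
    two-in-layer : ∀ v → 2 ≤ ∑[ u < n G ] 𝟙 (combine u v)
    two-in-layer v with hits (egg a₀ v) (egg∈eggs a₀ v)
    ... | x₁ , x₁∈egg , x₁∈S with ∈-egg⁻ {a₀} x₁ x₁∈egg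
    ... | u₁ , _ , refl with hits (egg u₁ v) (egg∈eggs u₁ v)
    ... | x₂ , x₂∈egg , x₂∈S with ∈-egg⁻ {u₁} x₂ x₂∈egg
    ... | u₂ , u₂≢u₁ , refl = subst (_≤ ∑[ u < n G ] 𝟙 (combine u v))
      (cong₂ _+_ (𝟙≡1 x₂∈S) (𝟙≡1 x₁∈S)) (fᵢ+fⱼ≤sum (λ u → 𝟙 (combine u v)) u₂≢u₁)

  module _ {A : Subset (n G * n H)} {a b v v′} (egg⊆A : egg a v ⊆ A) (egg⊆∁A : egg b v′ ⊆ ∁ A) where

    private
      L = edgeConn H
      D = δ G
      m = L ⊓ D

      hCut : Fin (n G) → ℕ
      hCut u = cutSize H (tabulate (hFibre G H A u))

      gCut : Fin (n H) → ℕ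
      gCut y = cutSize G (tabulate (gFibre G H A y))

      inside : ∀ {u} → u ≢ a → hFibre G H A u v ≡ true
      inside u≢a = []=⇒lookup (egg⊆A (∈-egg⁺ v u≢a))

      outside : ∀ {u} → u ≢ b → hFibre G H A u v′ ≡ false
      outside u≢b = ¬-not (x∈∁p⇒x∉p (egg⊆∁A (∈-egg⁺ v′ u≢b)) ∘ lookup⇒[]= _ A)

      v≢v′ : v ≢ v′
      v≢v′ refl with third-vertex (proj₁ κ≥2) a b
      ... | c , c≢a , c≢b = contradiction (trans (sym (inside c≢a)) (outside c≢b)) λ ()

      L≤hCut : ∀ {u y y′} → hFibre G H A u y ≡ true → hFibre G H A u y′ ≡ false → L ≤ hCut u
      L≤hCut = edgeConn≤cutSize H _

      L≤hCut-elsewhere : ∀ u → u ≢ a → u ≢ b → L ≤ hCut u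
      L≤hCut-elsewhere u u≢a u≢b = L≤hCut (inside u≢a) (outside u≢b)

      D≤gCut-⁅c⁆ : ∀ {y c} → gFibre G H A y c ≡ true → (∀ {u} → u ≢ c → gFibre G H A y u ≡ false) → D ≤ gCut y
      D≤gCut-⁅c⁆ {c = c} c∈ others = ≤-trans (δ≤deg G c) (deg≤cutSize-⁅i⁆ G isGraph _ c∈ others)

      D≤gCut-∁⁅c⁆ : ∀ {y c} → gFibre G H A y c ≡ false → (∀ {u} → u ≢ c → gFibre G H A y u ≡ true) → D ≤ gCut y
      D≤gCut-∁⁅c⁆ {c = c} c∉ others = ≤-trans (δ≤deg G c) (deg≤cutSize-∁⁅i⁆ G isGraph _ c∉ others)

      twice≤ : ∀ {x y} → m ≤ x → m ≤ y → 2 * m ≤ x + y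
      twice≤ {y = y} m≤x m≤y = +-mono-≤ m≤x (subst (_≤ y) (sym (+-identityʳ m)) m≤y)

      m≤hCut[a]+gCut[v] : a ≢ b → m ≤ hCut a + gCut v
      m≤hCut[a]+gCut[v] a≢b with hFibre G H A a v in e
      ... | true  = m≤n⇒m≤n+o (gCut v) (≤-trans (m⊓n≤m L D) (L≤hCut e (outside a≢b)))
      ... | false = m≤n⇒m≤o+n (hCut a) (≤-trans (m⊓n≤n L D) (D≤gCut-∁⁅c⁆ e inside))

      m≤hCut[b]+gCut[v′] : b ≢ a → m ≤ hCut b + gCut v′
      m≤hCut[b]+gCut[v′] b≢a with hFibre G H A b v′ in e
      ... | false = m≤n⇒m≤n+o (gCut v′) (≤-trans (m⊓n≤m L D) (L≤hCut (inside b≢a) e))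
      ... | true  = m≤n⇒m≤o+n (hCut b) (≤-trans (m⊓n≤n L D) (D≤gCut-⁅c⁆ e outside))

      m≤hCut[a]+gCut[v]+gCut[v′] : a ≡ b → m ≤ hCut a + (gCut v + gCut v′)
      m≤hCut[a]+gCut[v]+gCut[v′] refl with hFibre G H A a v in e | hFibre G H A a v′ in e′
      ... | true  | false = m≤n⇒m≤n+o (gCut v + gCut v′) (≤-trans (m⊓n≤m L D) (L≤hCut e e′))
      ... | false | true  = m≤n⇒m≤n+o (gCut v + gCut v′) (≤-trans (m⊓n≤m L D) (L≤hCut e′ e))
      ... | true  | true  = m≤n⇒m≤o+n (hCut a) (m≤n⇒m≤o+n (gCut v) (≤-trans (m⊓n≤n L D) (D≤gCut-⁅c⁆ e′ outside)))
      ... | false | false = m≤n⇒m≤o+n (hCut a) (m≤n⇒m≤n+o (gCut v′) (≤-trans (m⊓n≤n L D) (D≤gCut-∁⁅c⁆ e inside)))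

      [n∸2]*L+2*m≤∑hCut+∑gCut : Dec (a ≡ b) → (n G ∸ 2) * L + 2 * m ≤ sum hCut + sum gCut
      [n∸2]*L+2*m≤∑hCut+∑gCut (no a≢b) = [n∸2]c+k≤sum+sum hCut gCut a≢b v≢v′ L≤hCut-elsewhere
        (subst (2 * m ≤_) (interchange (hCut a) (gCut v) (hCut b) (gCut v′))
          (twice≤ (m≤hCut[a]+gCut[v] a≢b) (m≤hCut[b]+gCut[v′] (a≢b ∘ sym))))
      [n∸2]*L+2*m≤∑hCut+∑gCut (yes a≡b) with third-vertex (proj₁ κ≥2) a a
      ... | c , c≢a , _ = [n∸2]c+k≤sum+sum hCut gCut (c≢a ∘ sym) v≢v′
        (λ u u≢a _ → L≤hCut-elsewhere u u≢a (subst (u ≢_) a≡b u≢a))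
        (subst (2 * m ≤_) (xy∙z≈xz∙y (hCut a) (gCut v + gCut v′) (hCut c))
          (twice≤ (m≤hCut[a]+gCut[v]+gCut[v′] a≡b)
                  (≤-trans (m⊓n≤m L D) (L≤hCut-elsewhere c c≢a (subst (c ≢_) a≡b c≢a)))))

    eggCut-size : (n G ∸ 2) * edgeConn H + 2 * (edgeConn H ⊓ δ G) ≤ cutSize (G □ H) A
    eggCut-size = ≤-trans ([n∸2]*L+2*m≤∑hCut+∑gCut (a ≟ b)) (∑cutSize-fibres≤cutSize-□ G H A)

proposition4p3 : (G H : Graph) → IsGraph G → IsGraph H →
    Connected G → Connected H → VertexConnAtLeast G 2 →
    SnAtLeast (G □ H)
      ((2 * n H) ⊓ ((n G * edgeConn H) ⊓ (((n G ∸ 2) * edgeConn H) + 2 * δ G)))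
proposition4p3 G H isGraph _ _ _ κ≥2 =
  eggs G H isGraph κ≥2 , eggs-scramble G H isGraph κ≥2 , hitting-bound , eggCut-bound
  where
  bound : ℕ
  bound = (2 * n H) ⊓ ((n G * edgeConn H) ⊓ (((n G ∸ 2) * edgeConn H) + 2 * δ G))

  hitting-bound : ∀ S → IsHittingSet (G □ H) (eggs G H isGraph κ≥2) S → bound ≤ ∣ S ∣
  hitting-bound S hits = ≤-trans (m⊓n≤m _ _) (hittingSet-size G H isGraph κ≥2 S hits)

  eggCut-bound : ∀ A → IsEggCut (G □ H) (eggs G H isGraph κ≥2) A → bound ≤ cutSize (G □ H) A
  eggCut-bound A ((_ , E∈ , E⊆A) , (_ , E′∈ , E′⊆∁A))
    with ∈-eggs⁻ G H isGraph κ≥2 E∈ | ∈-eggs⁻ G H isGraph κ≥2 E′∈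
  ... | a , v , refl | b , v′ , refl = ≤-trans (m⊓n≤n _ _)
    (≤-trans (≤-reflexive (n*L⊓[[n∸2]*L+2*D]≡[n∸2]*L+2*[L⊓D] (<⇒≤ (proj₁ κ≥2)) (edgeConn H) (δ G)))
      (eggCut-size G H isGraph κ≥2 {A} {a} {b} {v} {v′} E⊆A E′⊆∁A))
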